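{- Let $v$ be a finite word over $\{1,2\}$ of length $\ell$ with the same number of $1$'s and $2$'s, and let $w=vvv\cdots$. Then $$(P_w-P_w)\cap\mathbb{N}^2=\Big(\big(P_w\cap\{0,\ldots,2\ell\}^2\big)-\big(P_w\cap\{0,\ldots,\ell\}^2\big)\Big)\cap\mathbb{N}^2+\{k\cdot(\ell,\ell):k\in\mathbb{N}\}.$$
   Context: $\mathbb{N}=\{0,1,2,\ldots\}$; for $A,B\subseteq\mathbb{Z}^2$, $A-B=\{\mathbf{a}-\mathbf{b}:\mathbf{a}\in A,\mathbf{b}\in B\}$ and $A+B=\{\mathbf{a}+\mathbf{b}\}$. Letters of an infinite word $w$ are indexed starting from $1$. For an infinite word $w$ over $\{1,2\}$ in which both letters occur infinitely often, let $A_m$ (resp. $B_m$) be the index of the $m$-th occurrence of $1$ (resp. $2$) in $w$, and $P_w=\{(0,0)\}\cup\{(A_m,B_m):m\ge1\}\cup\{(B_m,A_m):m\ge1\}$. -}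

module Defs where

open import Data.Nat using (ℕ; zero; suc; _+_; _≤_; _%_)
open import Data.Integer as ℤ using (ℤ; +_; _-_)
open import Data.List using (List; []; _∷_; length)
open import Data.Product using (Σ; _×_; _,_)
open import Data.Sum using (_⊎_)
open import Relation.Binary.PropositionalEquality using (_≡_; refl)
open import Relation.Nullary using (Dec; yes; no)

data Letter : Set where
  one two : Letter

_≟L_ : (a b : Letter) → Dec (a ≡ b)
one ≟L one = yes refl
one ≟L two = no (λ ())
two ≟L one = no (λ ())
two ≟L two = yes refl

countL : Letter → List Letter → ℕ
countL a [] = 0
countL a (x ∷ xs) with x ≟L a
... | yes _ = suc (countL a xs)
... | no  _ = countL a xs

-- 0-based lookup in a finite word (junk on out-of-range)
letterAt : List Letter → ℕ → Letter
letterAt [] _ = one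
letterAt (x ∷ xs) zero = x
letterAt (x ∷ xs) (suc n) = letterAt xs n

-- w = v v v ..., letters indexed from 1: w_i = v_{((i-1) mod ℓ)} (0-based in v).
-- Index 0 and the empty word give junk values, never used.
per : List Letter → ℕ → Letter
per [] _ = one
per (x ∷ xs) zero = one
per (x ∷ xs) (suc i) = letterAt (x ∷ xs) (i % suc (length xs))

cnt : List Letter → Letter → ℕ → ℕ
cnt v a zero = 0
cnt v a (suc n) with per v (suc n) ≟L a
... | yes _ = suc (cnt v a n)
... | no  _ = cnt v a n

Occ : List Letter → Letter → ℕ → ℕ → Set
Occ v a m i = (1 ≤ i) × (per v i ≡ a) × (cnt v a i ≡ m)

-- P_w = {(0,0)} ∪ {(A_m,B_m)} ∪ {(B_m,A_m)}, m ≥ 1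
P : List Letter → ℕ × ℕ → Set
P v (x , y) =
  ((x ≡ 0) × (y ≡ 0)) ⊎
  Σ ℕ λ m → (1 ≤ m) × Σ ℕ λ i → Σ ℕ λ j →
    Occ v one m i × Occ v two m j ×
    (((x , y) ≡ (i , j)) ⊎ ((x , y) ≡ (j , i)))

ℤ² : Set
ℤ² = ℤ × ℤ

InN2 : ℤ² → Set
InN2 (a , b) = (+ 0 ℤ.≤ a) × (+ 0 ℤ.≤ b)

diff : ℕ × ℕ → ℕ × ℕ → ℤ²
diff (a , b) (c , d) = ((+ a) - (+ c) , (+ b) - (+ d))

PBox : List Letter → ℕ → ℕ × ℕ → Set
PBox v N (x , y) = P v (x , y) × (x ≤ N) × (y ≤ N)

-- Since v is balanced, c = #₁(v) = #₂(v) ≥ 1, and shifting by one period of w = vvv… sends the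
-- m-th occurrence of either letter to its (m + c)-th occurrence.  Hence every point of P_w other
-- than the origin is a point of level m₀ ≤ c, which lies in {1,…,ℓ}², translated by s·(ℓ,ℓ).
-- For a difference p − q ∈ ℕ² of such points with shifts s and t one has t ≤ s; removing the
-- common shift t·(ℓ,ℓ) leaves either a difference of points in {0,…,ℓ}² (s = t), or, after moving
-- one period back onto p, a point of {0,…,2ℓ}² minus a point of {0,…,ℓ}² plus (s − t − 1)·(ℓ,ℓ).
module Submission where

open import Defs
open import Data.Nat
  using (ℕ; zero; suc; _+_; _*_; _≤_; _<_; _%_; _/_; z≤n; s≤s; _≤′_; ≤′-refl; ≤′-step; _≤?_; _<?_; NonZero; ≢-nonZero)
open import Data.Nat.Properties
open import Data.Nat.DivMod using ([m+kn]%n≡m%n; m<n⇒m%n≡m; m≡m%n+[m/n]*n; m%n<n)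
open import Data.Nat.Tactic.RingSolver using (solve-∀)
import Data.Integer as ℤ
import Data.Integer.Properties as ℤ
import Data.Integer.Tactic.RingSolver as ℤSolver
open import Data.List using (List; []; _∷_; length)
open import Data.Product using (Σ; _×_; _,_; proj₁; proj₂)
open import Data.Sum using (_⊎_; inj₁; inj₂)
open import Data.Empty using (⊥-elim)
open import Function.Bundles using (_⇔_; mk⇔)
open import Relation.Binary.PropositionalEquality
open import Relation.Nullary using (yes; no)
open import Algebra.Properties.CommutativeSemigroup +-commutativeSemigroup using (x∙yz≈y∙xz)

δ : Letter → Letter → ℕ
δ b a with b ≟L a
... | yes _ = 1
... | no  _ = 0

countL-cons : ∀ a y ys → countL a (y ∷ ys) ≡ δ y a + countL a ys
countL-cons a y ys with y ≟L a
... | yes _ = refl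
... | no  _ = refl

countL-one+two : ∀ u → countL one u + countL two u ≡ length u
countL-one+two []         = refl
countL-one+two (one ∷ ys) = cong suc (countL-one+two ys)
countL-one+two (two ∷ ys) = trans (+-suc (countL one ys) (countL two ys)) (cong suc (countL-one+two ys))

prefixCount : List Letter → Letter → ℕ → ℕ
prefixCount u a zero    = 0
prefixCount u a (suc n) = δ (letterAt u n) a + prefixCount u a n

prefixCount-cons : ∀ y ys a n → prefixCount (y ∷ ys) a (suc n) ≡ δ y a + prefixCount ys a n
prefixCount-cons y ys a zero    = refl
prefixCount-cons y ys a (suc n) = begin
  δ (letterAt ys n) a + prefixCount (y ∷ ys) a (suc n) ≡⟨ cong (δ (letterAt ys n) a +_) (prefixCount-cons y ys a n) ⟩
  δ (letterAt ys n) a + (δ y a + prefixCount ys a n)   ≡⟨ x∙yz≈y∙xz (δ (letterAt ys n) a) (δ y a) _ ⟩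
  δ y a + (δ (letterAt ys n) a + prefixCount ys a n)   ∎
  where open ≡-Reasoning

prefixCount-length : ∀ u a → prefixCount u a (length u) ≡ countL a u
prefixCount-length []       a = refl
prefixCount-length (y ∷ ys) a = begin
  prefixCount (y ∷ ys) a (suc (length ys)) ≡⟨ prefixCount-cons y ys a (length ys) ⟩
  δ y a + prefixCount ys a (length ys)      ≡⟨ cong (δ y a +_) (prefixCount-length ys a) ⟩
  δ y a + countL a ys                       ≡⟨ countL-cons a y ys ⟨
  countL a (y ∷ ys)                         ∎
  where open ≡-Reasoning

module Counting (v : List Letter) where

  cnt-suc : ∀ a n → cnt v a (suc n) ≡ δ (per v (suc n)) a + cnt v a n
  cnt-suc a n with per v (suc n) ≟L a
  ... | yes _ = refl
  ... | no  _ = refl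

  cnt-hit : ∀ {a} n → per v (suc n) ≡ a → cnt v a (suc n) ≡ suc (cnt v a n)
  cnt-hit {a} n hit with per v (suc n) ≟L a
  ... | yes _   = refl
  ... | no miss = ⊥-elim (miss hit)

  cnt-mono′ : ∀ {a m n} → m ≤′ n → cnt v a m ≤ cnt v a n
  cnt-mono′ ≤′-refl = ≤-refl
  cnt-mono′ {a} (≤′-step {n} m≤′n) =
    ≤-trans (cnt-mono′ m≤′n) (≤-trans (m≤n+m (cnt v a n) _) (≤-reflexive (sym (cnt-suc a n))))

  cnt-mono : ∀ {a m n} → m ≤ n → cnt v a m ≤ cnt v a n
  cnt-mono m≤n = cnt-mono′ (≤⇒≤′ m≤n)

  Occ-level-pos : ∀ {a m i} → Occ v a m i → 1 ≤ m
  Occ-level-pos {i = suc i} (_ , hit , counts) = subst (1 ≤_) (trans (sym (cnt-hit i hit)) counts) (s≤s z≤n)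

  Occ-index-> : ∀ {a m i n} → Occ v a m i → cnt v a n < m → n < i
  Occ-index-> {a} {i = i} {n} (_ , _ , counts) cnt<m with n <? i
  ... | yes n<i = n<i
  ... | no  n≮i = ⊥-elim (<⇒≱ cnt<m (subst (_≤ cnt v a n) counts (cnt-mono (≮⇒≥ n≮i))))

  Occ-index-≤ : ∀ {a m i n} → Occ v a m i → m ≤ cnt v a n → i ≤ n
  Occ-index-≤ {a} {m} {suc i} {n} (_ , hit , counts) m≤cnt with suc i ≤? n
  ... | yes i≤n = i≤n
  ... | no  i≰n = ⊥-elim (n≮n m (begin-strict
    m                 ≤⟨ m≤cnt ⟩
    cnt v a n         ≤⟨ cnt-mono (≤-pred (≰⇒> i≰n)) ⟩
    cnt v a i         <⟨ n<1+n (cnt v a i) ⟩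
    suc (cnt v a i)   ≡⟨ cnt-hit i hit ⟨
    cnt v a (suc i)   ≡⟨ counts ⟩
    m                 ∎))
    where open ≤-Reasoning

  Occ-exists : ∀ {a m} n → 1 ≤ m → m ≤ cnt v a n → Σ ℕ (Occ v a m)
  Occ-exists zero 1≤m m≤0 = ⊥-elim (n≮n 0 (≤-trans 1≤m m≤0))
  Occ-exists {a} {m} (suc n) 1≤m m≤cnt with per v (suc n) ≟L a | m ≤? cnt v a n
  ... | _       | yes m≤cnt′ = Occ-exists n 1≤m m≤cnt′
  ... | no _    | no _       = Occ-exists n 1≤m m≤cnt
  ... | yes hit | no m≰cnt′  = suc n , s≤s z≤n , hit ,
    trans (cnt-hit n hit) (≤-antisym (≰⇒> m≰cnt′) m≤cnt)

module Periodic (x : Letter) (xs : List Letter) where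

  v : List Letter
  v = x ∷ xs

  ℓ : ℕ
  ℓ = length v

  open Counting v public

  per-periodic : ∀ s i → per v (suc (s * ℓ + i)) ≡ per v (suc i)
  per-periodic s i = cong (letterAt v) (trans (cong (_% ℓ) (+-comm (s * ℓ) i)) ([m+kn]%n≡m%n i s ℓ))

  cnt-prefix : ∀ a n → n ≤ ℓ → cnt v a n ≡ prefixCount v a n
  cnt-prefix a zero    _   = refl
  cnt-prefix a (suc n) n<ℓ = trans (cnt-suc a n)
    (cong₂ _+_ (cong (λ k → δ (letterAt v k) a) (m<n⇒m%n≡m n<ℓ)) (cnt-prefix a n (<⇒≤ n<ℓ)))

  cnt-period : ∀ a → cnt v a ℓ ≡ countL a v
  cnt-period a = trans (cnt-prefix a ℓ ≤-refl) (prefixCount-length v a)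

  cnt-+ : ∀ a s n → cnt v a (s * ℓ + n) ≡ cnt v a (s * ℓ) + cnt v a n
  cnt-+ a s zero    = trans (cong (cnt v a) (+-identityʳ (s * ℓ))) (sym (+-identityʳ _))
  cnt-+ a s (suc n) = begin
    cnt v a (s * ℓ + suc n)                              ≡⟨ cong (cnt v a) (+-suc (s * ℓ) n) ⟩
    cnt v a (suc (s * ℓ + n))                            ≡⟨ cnt-suc a (s * ℓ + n) ⟩
    δ (per v (suc (s * ℓ + n))) a + cnt v a (s * ℓ + n)
      ≡⟨ cong₂ _+_ (cong (λ b → δ b a) (per-periodic s n)) (cnt-+ a s n) ⟩
    δ (per v (suc n)) a + (cnt v a (s * ℓ) + cnt v a n)
      ≡⟨ x∙yz≈y∙xz (δ (per v (suc n)) a) (cnt v a (s * ℓ)) _ ⟩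
    cnt v a (s * ℓ) + (δ (per v (suc n)) a + cnt v a n)  ≡⟨ cong (cnt v a (s * ℓ) +_) (cnt-suc a n) ⟨
    cnt v a (s * ℓ) + cnt v a (suc n)                    ∎
    where open ≡-Reasoning

  cnt-*ℓ : ∀ a s → cnt v a (s * ℓ) ≡ s * countL a v
  cnt-*ℓ a zero    = refl
  cnt-*ℓ a (suc s) = begin
    cnt v a (ℓ + s * ℓ)            ≡⟨ cong (cnt v a) (+-comm ℓ (s * ℓ)) ⟩
    cnt v a (s * ℓ + ℓ)            ≡⟨ cnt-+ a s ℓ ⟩
    cnt v a (s * ℓ) + cnt v a ℓ    ≡⟨ cong₂ _+_ (cnt-*ℓ a s) (cnt-period a) ⟩
    s * countL a v + countL a v    ≡⟨ +-comm (s * countL a v) (countL a v) ⟩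
    suc s * countL a v             ∎
    where open ≡-Reasoning

  cnt-shift : ∀ a s n → cnt v a (s * ℓ + n) ≡ s * countL a v + cnt v a n
  cnt-shift a s n = trans (cnt-+ a s n) (cong (_+ cnt v a n) (cnt-*ℓ a s))

  Occ-shift : ∀ {a m i} s → Occ v a m i → Occ v a (s * countL a v + m) (s * ℓ + i)
  Occ-shift {a} {i = suc i} s (_ , hit , counts) =
      ≤-trans (s≤s z≤n) (m≤n+m (suc i) (s * ℓ))
    , trans (cong (per v) (+-suc (s * ℓ) i)) (trans (per-periodic s i) hit)
    , trans (cnt-shift a s (suc i)) (cong (s * countL a v +_) counts)

  Occ-unshift : ∀ {a m i} s → 1 ≤ m → Occ v a (s * countL a v + m) i →
                Σ ℕ λ i₀ → (i ≡ s * ℓ + i₀) × Occ v a m i₀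
  Occ-unshift {a} {m} s 1≤m occ@(_ , hit , counts)
    with m≤n⇒∃[o]m+o≡n (Occ-index-> {n = s * ℓ} occ
                          (subst (_< s * countL a v + m) (sym (cnt-*ℓ a s)) (m<m+n _ 1≤m)))
  ... | o , refl = suc o , sym (+-suc (s * ℓ) o) , s≤s z≤n
                 , trans (sym (per-periodic s o)) hit
                 , +-cancelˡ-≡ (s * countL a v) _ _
                     (trans (sym (cnt-shift a s (suc o))) (trans (cong (cnt v a) (+-suc (s * ℓ) o)) counts))

suc-divMod : ∀ n d .{{_ : NonZero d}} → suc n ≡ (n / d) * d + suc (n % d)
suc-divMod n d = trans (cong suc (m≡m%n+[m/n]*n n d)) (+-comm (suc (n % d)) ((n / d) * d))

block-index-mono : ∀ {t s a b} ℓ → 1 ≤ b → a ≤ ℓ → t * ℓ + b ≤ s * ℓ + a → t ≤ s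
block-index-mono {t} {s} {a} {b} ℓ 1≤b a≤ℓ le = ≤-pred (*-cancelʳ-< ℓ t (suc s) (begin-strict
  t * ℓ      <⟨ m<m+n (t * ℓ) 1≤b ⟩
  t * ℓ + b  ≤⟨ le ⟩
  s * ℓ + a  ≤⟨ +-monoʳ-≤ (s * ℓ) a≤ℓ ⟩
  s * ℓ + ℓ  ≡⟨ +-comm (s * ℓ) ℓ ⟩
  suc s * ℓ  ∎))
  where open ≤-Reasoning

-- n is added on the left, so that shift 0 p is p definitionally.
shift : ℕ → ℕ × ℕ → ℕ × ℕ
shift n p = (n + proj₁ p , n + proj₂ p)

diag : ℕ → ℕ × ℕ
diag n = (n , n)

_≤²_ : ℕ × ℕ → ℕ × ℕ → Set
p ≤² q = (proj₁ p ≤ proj₁ q) × (proj₂ p ≤ proj₂ q)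

≤²-trans : ∀ {p q r} → p ≤² q → q ≤² r → p ≤² r
≤²-trans (a≤c , b≤d) (c≤e , d≤f) = ≤-trans a≤c c≤e , ≤-trans b≤d d≤f

-- Defined through projections, so that it unfolds to the shape used in lemma6p4.
_+diag_ : ℤ² → ℕ → ℤ²
z +diag n = (proj₁ z ℤ.+ ℤ.+ n , proj₂ z ℤ.+ ℤ.+ n)

InN2-diff : ∀ {p q} → q ≤² p → InN2 (diff p q)
InN2-diff (a≤c , b≤d) = ℤ.i≤j⇒0≤j-i (ℤ.+≤+ a≤c) , ℤ.i≤j⇒0≤j-i (ℤ.+≤+ b≤d)

InN2-diff⁻¹ : ∀ {p q} → InN2 (diff p q) → q ≤² p
InN2-diff⁻¹ (h₁ , h₂) = ℤ.drop‿+≤+ (ℤ.0≤i-j⇒j≤i h₁) , ℤ.drop‿+≤+ (ℤ.0≤i-j⇒j≤i h₂)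

diff-self : ∀ p → diff p p ≡ (ℤ.+ 0 , ℤ.+ 0)
diff-self (a , b) = cong₂ _,_ (ℤ.+-inverseʳ (ℤ.+ a)) (ℤ.+-inverseʳ (ℤ.+ b))

+-shift-diff : ∀ {n m j k} a b → n ≡ m + j + k →
               ℤ.+ (n + a) ℤ.- ℤ.+ (m + b) ≡ (ℤ.+ (j + a) ℤ.- ℤ.+ b) ℤ.+ ℤ.+ k
+-shift-diff {m = m} {j} {k} a b refl = begin
  ℤ.+ (m + j + k + a) ℤ.- ℤ.+ (m + b)
    ≡⟨ cong₂ ℤ._-_ (ℤ.pos-+ (m + j + k) a) (ℤ.pos-+ m b) ⟩
  (ℤ.+ (m + j + k) ℤ.+ ℤ.+ a) ℤ.- (ℤ.+ m ℤ.+ ℤ.+ b)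
    ≡⟨ cong (λ t → (t ℤ.+ ℤ.+ a) ℤ.- (ℤ.+ m ℤ.+ ℤ.+ b))
            (trans (ℤ.pos-+ (m + j) k) (cong (ℤ._+ ℤ.+ k) (ℤ.pos-+ m j))) ⟩
  (ℤ.+ m ℤ.+ ℤ.+ j ℤ.+ ℤ.+ k ℤ.+ ℤ.+ a) ℤ.- (ℤ.+ m ℤ.+ ℤ.+ b)
    ≡⟨ cancel (ℤ.+ m) (ℤ.+ j) (ℤ.+ k) (ℤ.+ a) (ℤ.+ b) ⟩
  (ℤ.+ j ℤ.+ ℤ.+ a ℤ.- ℤ.+ b) ℤ.+ ℤ.+ k
    ≡⟨ cong (λ t → (t ℤ.- ℤ.+ b) ℤ.+ ℤ.+ k) (ℤ.pos-+ j a) ⟨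
  (ℤ.+ (j + a) ℤ.- ℤ.+ b) ℤ.+ ℤ.+ k ∎
  where
  open ≡-Reasoning
  cancel : ∀ m j k a b → (m ℤ.+ j ℤ.+ k ℤ.+ a) ℤ.- (m ℤ.+ b) ≡ (j ℤ.+ a ℤ.- b) ℤ.+ k
  cancel = ℤSolver.solve-∀

diff-shift : ∀ {n m j k} p q → n ≡ m + j + k → diff (shift n p) (shift m q) ≡ diff (shift j p) q +diag k
diff-shift (a , b) (c , d) eq = cong₂ _,_ (+-shift-diff a c eq) (+-shift-diff b d eq)

shift-mono : ∀ {p q} n → p ≤² q → shift n p ≤² shift n q
shift-mono n (a≤c , b≤d) = +-monoʳ-≤ n a≤c , +-monoʳ-≤ n b≤d

shift-cancel : ∀ {p q} n → shift n p ≤² shift n q → p ≤² q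
shift-cancel n (a≤c , b≤d) = +-cancelˡ-≤ n _ _ a≤c , +-cancelˡ-≤ n _ _ b≤d

diag≤shift : ∀ n p → diag n ≤² shift n p
diag≤shift n p = m≤m+n n (proj₁ p) , m≤m+n n (proj₂ p)

≤²-shift : ∀ n p → p ≤² shift n p
≤²-shift n p = m≤n+m (proj₁ p) n , m≤n+m (proj₂ p) n

Pair : List Letter → ℕ → ℕ × ℕ → Set
Pair v m p = Σ ℕ λ i → Σ ℕ λ j → Occ v one m i × Occ v two m j × ((p ≡ (i , j)) ⊎ (p ≡ (j , i)))

module Balanced (x : Letter) (xs : List Letter) (balanced : countL one (x ∷ xs) ≡ countL two (x ∷ xs)) where

  open Periodic x xs public

  c : ℕ
  c = countL one v

  countL≡c : ∀ a → countL a v ≡ c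
  countL≡c one = refl
  countL≡c two = sym balanced

  c≢0 : c ≢ 0
  c≢0 c≡0 = 0≢1+n (begin
    0                         ≡⟨ cong₂ _+_ c≡0 (trans (sym balanced) c≡0) ⟨
    c + countL two v          ≡⟨ countL-one+two v ⟩
    ℓ                         ∎)
    where open ≡-Reasoning

  instance
    c-nonZero : NonZero c
    c-nonZero = ≢-nonZero c≢0

  Occ-shiftᶜ : ∀ {a m i} s → Occ v a m i → Occ v a (s * c + m) (s * ℓ + i)
  Occ-shiftᶜ {a} {m} {i} s occ = subst (λ k → Occ v a (s * k + m) (s * ℓ + i)) (countL≡c a) (Occ-shift s occ)

  Occ-unshiftᶜ : ∀ {a m i} s → 1 ≤ m → Occ v a (s * c + m) i →
                 Σ ℕ λ i₀ → (i ≡ s * ℓ + i₀) × Occ v a m i₀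
  Occ-unshiftᶜ {a} {m} {i} s 1≤m occ =
    Occ-unshift s 1≤m (subst (λ k → Occ v a (s * k + m) i) (sym (countL≡c a)) occ)

  Occ-in-period : ∀ {a m i} → m ≤ c → Occ v a m i → i ≤ ℓ
  Occ-in-period {a} {m} m≤c occ = Occ-index-≤ occ (subst (m ≤_) (sym (trans (cnt-period a) (countL≡c a))) m≤c)

  Pair⇒P : ∀ {m p} → Pair v m p → P v p
  Pair⇒P {m} pair@(_ , _ , occ , _) = inj₂ (m , Occ-level-pos occ , pair)

  Pair-shift : ∀ {m p} s → Pair v m p → Pair v (s * c + m) (shift (s * ℓ) p)
  Pair-shift s (i , j , occ₁ , occ₂ , inj₁ refl) =
    s * ℓ + i , s * ℓ + j , Occ-shiftᶜ s occ₁ , Occ-shiftᶜ s occ₂ , inj₁ refl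
  Pair-shift s (i , j , occ₁ , occ₂ , inj₂ refl) =
    s * ℓ + i , s * ℓ + j , Occ-shiftᶜ s occ₁ , Occ-shiftᶜ s occ₂ , inj₂ refl

  Pair-shift-period : ∀ {m p} → Pair v m p → Pair v (1 * c + m) (shift ℓ p)
  Pair-shift-period {m} {p} pair =
    subst (λ n → Pair v (1 * c + m) (shift n p)) (*-identityˡ ℓ) (Pair-shift 1 pair)

  Pair-unshift : ∀ {m p} s → 1 ≤ m → Pair v (s * c + m) p →
                 Σ (ℕ × ℕ) λ p₀ → (p ≡ shift (s * ℓ) p₀) × Pair v m p₀
  Pair-unshift s 1≤m (_ , _ , occ₁ , occ₂ , _)
    with Occ-unshiftᶜ s 1≤m occ₁ | Occ-unshiftᶜ s 1≤m occ₂
  Pair-unshift s 1≤m (_ , _ , _ , _ , inj₁ refl) | i₀ , refl , occ₁ | j₀ , refl , occ₂ =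
    (i₀ , j₀) , refl , i₀ , j₀ , occ₁ , occ₂ , inj₁ refl
  Pair-unshift s 1≤m (_ , _ , _ , _ , inj₂ refl) | i₀ , refl , occ₁ | j₀ , refl , occ₂ =
    (j₀ , i₀) , refl , i₀ , j₀ , occ₁ , occ₂ , inj₂ refl

  Pair-in-period : ∀ {m p} → m ≤ c → Pair v m p → p ≤² diag ℓ
  Pair-in-period m≤c (_ , _ , occ₁ , occ₂ , inj₁ refl) = Occ-in-period m≤c occ₁ , Occ-in-period m≤c occ₂
  Pair-in-period m≤c (_ , _ , occ₁ , occ₂ , inj₂ refl) = Occ-in-period m≤c occ₂ , Occ-in-period m≤c occ₁

  Pair-pos : ∀ {m p} → Pair v m p → diag 1 ≤² p
  Pair-pos (_ , _ , occ₁ , occ₂ , inj₁ refl) = proj₁ occ₁ , proj₁ occ₂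
  Pair-pos (_ , _ , occ₁ , occ₂ , inj₂ refl) = proj₁ occ₂ , proj₁ occ₁

  Pair-exists : Σ (ℕ × ℕ) (Pair v 1)
  Pair-exists
    with Occ-exists {one} ℓ ≤-refl (first-in-period one) | Occ-exists {two} ℓ ≤-refl (first-in-period two)
    where
    first-in-period : ∀ a → 1 ≤ cnt v a ℓ
    first-in-period a = subst (1 ≤_) (sym (trans (cnt-period a) (countL≡c a))) (n≢0⇒n>0 c≢0)
  ... | i , occ₁ | j , occ₂ = (i , j) , i , j , occ₁ , occ₂ , inj₁ refl

  Pair-reduce : ∀ {m p} → 1 ≤ m → Pair v m p →
                Σ ℕ λ m₀ → Σ (ℕ × ℕ) λ p₀ → Σ ℕ λ s →
                  Pair v m₀ p₀ × p₀ ≤² diag ℓ × (p ≡ shift (s * ℓ) p₀)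
  Pair-reduce {suc n} {p} (s≤s _) pair
    with Pair-unshift (n / c) (s≤s z≤n) (subst (λ m → Pair v m p) (suc-divMod n c) pair)
  ... | p₀ , p≡ , pair₀ = suc (n % c) , p₀ , n / c , pair₀ , Pair-in-period (m%n<n n c) pair₀ , p≡

  InDifferenceSet : ℤ² → Set
  InDifferenceSet z = (Σ (ℕ × ℕ) λ p → Σ (ℕ × ℕ) λ q → P v p × P v q × (z ≡ diff p q)) × InN2 z

  InBoxedDifferenceSet : ℤ² → Set
  InBoxedDifferenceSet z = Σ (ℕ × ℕ) λ p → Σ (ℕ × ℕ) λ q → Σ ℕ λ k →
    PBox v (2 * ℓ) p × PBox v ℓ q × InN2 (diff p q) × (z ≡ diff p q +diag (k * ℓ))

  origin-PBox : ∀ N → PBox v N (0 , 0)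
  origin-PBox N = inj₁ (refl , refl) , z≤n , z≤n

  diag-ℓ≤2ℓ : diag ℓ ≤² diag (2 * ℓ)
  diag-ℓ≤2ℓ = m≤m+n ℓ _ , m≤m+n ℓ _

  reduce-shifted-pairs : ∀ {m n p₀ q₀} s t →
                         Pair v m p₀ → p₀ ≤² diag ℓ → Pair v n q₀ → q₀ ≤² diag ℓ →
                         shift (t * ℓ) q₀ ≤² shift (s * ℓ) p₀ →
                         InBoxedDifferenceSet (diff (shift (s * ℓ) p₀) (shift (t * ℓ) q₀))
  reduce-shifted-pairs {p₀ = p₀} {q₀} s t pair p₀≤ℓ pair′ q₀≤ℓ q≤p
    with m≤n⇒m<n∨m≡n (block-index-mono {t} {s} ℓ (proj₁ (Pair-pos pair′)) (proj₁ p₀≤ℓ) (proj₁ q≤p))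
  ... | inj₂ refl =
    p₀ , q₀ , 0 , (Pair⇒P pair , ≤²-trans p₀≤ℓ diag-ℓ≤2ℓ) , (Pair⇒P pair′ , q₀≤ℓ) ,
    InN2-diff (shift-cancel (t * ℓ) q≤p) ,
    diff-shift {m = t * ℓ} p₀ q₀ (sym (trans (+-identityʳ _) (+-identityʳ _)))
  ... | inj₁ t<s with m≤n⇒∃[o]m+o≡n t<s
  ...   | k , refl =
    shift ℓ p₀ , q₀ , k , (Pair⇒P (Pair-shift-period pair) , ≤²-trans (shift-mono ℓ p₀≤ℓ) diag-2ℓ) ,
    (Pair⇒P pair′ , q₀≤ℓ) , InN2-diff (≤²-trans q₀≤ℓ (diag≤shift ℓ p₀)) ,
    diff-shift {m = t * ℓ} {ℓ} p₀ q₀ (blocks t k ℓ)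
    where
    diag-2ℓ : shift ℓ (diag ℓ) ≤² diag (2 * ℓ)
    diag-2ℓ = ≤-reflexive ℓ+ℓ≡2ℓ , ≤-reflexive ℓ+ℓ≡2ℓ
      where
      ℓ+ℓ≡2ℓ : ℓ + ℓ ≡ 2 * ℓ
      ℓ+ℓ≡2ℓ = cong (ℓ +_) (sym (+-identityʳ ℓ))
    blocks : ∀ t k ℓ → (suc t + k) * ℓ ≡ t * ℓ + ℓ + k * ℓ
    blocks = solve-∀

  reduce-difference : ∀ {p q} → P v p → P v q → q ≤² p → InBoxedDifferenceSet (diff p q)
  reduce-difference {0 , 0} {0 , 0} (inj₁ (refl , refl)) (inj₁ (refl , refl)) _ =
    (0 , 0) , (0 , 0) , 0 , origin-PBox (2 * ℓ) , origin-PBox ℓ , InN2-diff (z≤n , z≤n) , refl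
  reduce-difference {_ , _} {0 , 0} (inj₂ (_ , 1≤m , pair)) (inj₁ (refl , refl)) _
    with Pair-reduce 1≤m pair
  ... | _ , p₀ , s , pair₀ , p₀≤ℓ , refl =
    p₀ , (0 , 0) , s , (Pair⇒P pair₀ , ≤²-trans p₀≤ℓ diag-ℓ≤2ℓ) , origin-PBox ℓ , InN2-diff (z≤n , z≤n) ,
    diff-shift {m = 0} {0} p₀ (0 , 0) refl
  reduce-difference {0 , 0} {_ , _} (inj₁ (refl , refl)) (inj₂ (_ , _ , pair)) (q₁≤0 , _) =
    ⊥-elim (n≮n 0 (≤-trans (proj₁ (Pair-pos pair)) q₁≤0))
  reduce-difference {_ , _} {_ , _} (inj₂ (_ , 1≤m , pair)) (inj₂ (_ , 1≤n , pair′)) q≤p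
    with Pair-reduce 1≤m pair | Pair-reduce 1≤n pair′
  ... | _ , p₀ , s , pair₀ , p₀≤ℓ , refl | _ , q₀ , t , pair₀′ , q₀≤ℓ , refl =
    reduce-shifted-pairs s t pair₀ p₀≤ℓ pair₀′ q₀≤ℓ q≤p

  ∈DifferenceSet : ∀ {p q} → P v p → P v q → q ≤² p → InDifferenceSet (diff p q)
  ∈DifferenceSet {p} {q} Pp Pq q≤p = (p , q , Pp , Pq , refl) , InN2-diff q≤p

  expand-difference : ∀ {p q} k → P v p → P v q → q ≤² p → InDifferenceSet (diff p q +diag (k * ℓ))
  expand-difference {0 , 0} {0 , 0} k (inj₁ (refl , refl)) _ (z≤n , z≤n) with Pair-exists
  ... | r , pair = subst InDifferenceSet
    (trans (diff-shift {m = 0} {0} r r refl) (cong (_+diag (k * ℓ)) (diff-self r)))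
    (∈DifferenceSet (Pair⇒P (Pair-shift k pair)) (Pair⇒P pair) (≤²-shift (k * ℓ) r))
  expand-difference {p@(_ , _)} {q} k (inj₂ (_ , _ , pair)) Pq q≤p = subst InDifferenceSet
    (diff-shift {m = 0} {0} p q refl)
    (∈DifferenceSet (Pair⇒P (Pair-shift k pair)) Pq (≤²-trans q≤p (≤²-shift (k * ℓ) p)))

lemma6p4 : (x : Letter) (xs : List Letter) →
    let v = x ∷ xs
        ℓ = length v
    in countL one v ≡ countL two v →
    (z : ℤ²) →
    ((Σ (ℕ × ℕ) λ p → Σ (ℕ × ℕ) λ q → P v p × P v q × (z ≡ diff p q)) × InN2 z)
    ⇔
    (Σ (ℕ × ℕ) λ p → Σ (ℕ × ℕ) λ q → Σ ℕ λ k →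
       PBox v (2 * ℓ) p × PBox v ℓ q × InN2 (diff p q) ×
       (z ≡ ((proj₁ (diff p q) ℤ.+ ℤ.+ (k * ℓ)) , (proj₂ (diff p q) ℤ.+ ℤ.+ (k * ℓ)))))
lemma6p4 x xs balanced z = mk⇔ (reduce z) (expand z)
  where
  open Balanced x xs balanced

  reduce : ∀ z → InDifferenceSet z → InBoxedDifferenceSet z
  reduce _ ((_ , _ , Pp , Pq , refl) , z∈ℕ²) = reduce-difference Pp Pq (InN2-diff⁻¹ z∈ℕ²)

  expand : ∀ z → InBoxedDifferenceSet z → InDifferenceSet z
  expand _ (_ , _ , k , (Pp , _) , (Pq , _) , pq∈ℕ² , refl) = expand-difference k Pp Pq (InN2-diff⁻¹ pq∈ℕ²)
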